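{- The competitive ratio of the online simple unbounded knapsack problem is $2$. That is, there is a deterministic online algorithm whose (strict) competitive ratio is at most $2$, and for every deterministic online algorithm and every $c<2$ there is an instance on which its competitive ratio exceeds $c$.
   Context: Online simple unbounded knapsack problem: the knapsack has capacity $1$. An instance is a finite sequence of items $x_1,\dots,x_n$ (with $n$ unknown to the algorithm), item $x_i$ having a size $s_i\in[0,1]$ and a value $v_i=s_i$. Items arrive one by one; upon arrival of $x_i$ the algorithm must irrevocably decide a number $k_i\in\mathbb{N}_0$ of copies of $x_i$ to pack, subject to $\sum_i k_i s_i\le 1$ at all times. The gain $\mathrm{gain}_{\mathrm{ALG}}(I)$ is the total value packed, and $\mathrm{opt}(I)=\max\{\sum_i k_i v_i : k_i\in\mathbb{N}_0,\ \sum_i k_i s_i\le 1\}$. The (strict) competitive ratio of an algorithm on $I$ is $\mathrm{opt}(I)/\mathrm{gain}_{\mathrm{ALG}}(I)$ (infinite if the gain is $0$ and $\mathrm{opt}(I)>0$); the competitive ratio of the algorithm is the supremum over all instances, and the competitive ratio of the problem is the infimum over all algorithms.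
   Formalization: The item sizes $s_i$ are rational numbers in $[0,1]$, so the online algorithms act on rational sizes only, and the constant c in the lower bound ranges over the rationals. -}

module Defs where

open import Data.Nat using (ℕ)
open import Data.Integer using (+_)
open import Data.Rational using (ℚ; _/_; _+_; _*_; _≤_; 0ℚ; 1ℚ)
open import Data.List using (List; []; _∷_; _++_; [_]; length)
open import Data.List.Relation.Unary.All using (All)
open import Data.Product using (_×_)
open import Relation.Binary.PropositionalEquality using (_≡_)

ℕ→ℚ : ℕ → ℚ
ℕ→ℚ k = + k / 1

-- An instance: the list of item sizes in arrival order (value = size).
Instance : Set
Instance = List ℚ

ValidInstance : Instance → Set
ValidInstance I = All (λ s → (0ℚ ≤ s) × (s ≤ 1ℚ)) I

-- A deterministic online algorithm: given the sizes of the items seen so far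
-- (in arrival order) and the size of the current item, it returns the number
-- of copies of the current item to pack.  (Its previous decisions are a
-- function of the previous items, so they need not be passed explicitly.)
OnlineAlg : Set
OnlineAlg = List ℚ → ℚ → ℕ

gainFrom : OnlineAlg → List ℚ → Instance → ℚ
gainFrom A hist [] = 0ℚ
gainFrom A hist (x ∷ xs) = ℕ→ℚ (A hist x) * x + gainFrom A (hist ++ [ x ]) xs

gain : OnlineAlg → Instance → ℚ
gain A I = gainFrom A [] I

-- An algorithm is admissible if it never exceeds the capacity 1.
-- (Since the load is monotone and every prefix of a valid instance is a
-- valid instance, this is "at all times".)
Admissible : OnlineAlg → Set
Admissible A = (I : Instance) → ValidInstance I → gain A I ≤ 1ℚ

packValue : Instance → List ℕ → ℚ
packValue [] _ = 0ℚ
packValue (_ ∷ _) [] = 0ℚ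
packValue (s ∷ I) (k ∷ ks) = ℕ→ℚ k * s + packValue I ks

FeasiblePacking : Instance → List ℕ → Set
FeasiblePacking I ks = (length ks ≡ length I) × (packValue I ks ≤ 1ℚ)

{-# OPTIONS --safe #-}
-- Upper bound: the algorithm packs ⌊1/x⌋ copies of the first nonzero item x and nothing
-- afterwards.  For 0 < x ≤ 1 this fills at least half of the knapsack, while no packing
-- exceeds 1; if every item is zero, both sides are 0.
-- Lower bound: offer one item of size a slightly above ½.  An algorithm that rejects it
-- gains 0 against a > 0.  Otherwise it is stuck with gain a, since a second copy or a later
-- item of size ½ no longer fits, whereas two copies of that ½ give 1.  The ratio 1/a
-- tends to 2 as a tends to ½.
module Submission where

open import Defs
open import Data.Nat as ℕ using (ℕ; zero; suc)
import Data.Nat.Properties as ℕ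
open import Data.Nat.DivMod using (_/_; _%_; m≡m%n+[m/n]*n; m%n<n; m/n*n≤m; m≥n⇒m/n>0)
open import Data.Nat.Coprimality using (Coprime)
open import Data.Integer as ℤ using (+_; -[1+_])
import Data.Integer.Properties as ℤ
open import Data.Rational
  using (ℚ; mkℚ; toℚᵘ; _≟_; _+_; _*_; _-_; _≤_; _<_; _≤?_; _<?_; 0ℚ; 1ℚ; ½; *<*; nonNegative; positive)
  renaming (_/_ to _/ℚ_)
open import Data.Rational.Properties
open import Data.Rational.Solver using (module +-*-Solver)
open import Data.Rational.Unnormalised as ℚᵘ using (mkℚᵘ; _≃_)
import Data.Rational.Unnormalised.Properties as ℚᵘ
open import Data.List using (List; []; _∷_; _++_; [_])
import Data.List.Properties as List
open import Data.List.Relation.Unary.All using (All; []; _∷_; all?)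
open import Data.List.Relation.Unary.All.Properties using (++⁻ˡ; ++⁻ʳ)
open import Data.List.Relation.Unary.First as First using (FirstView)
open import Function using (_∘_)
open import Data.Product using (Σ; _×_; _,_)
open import Data.Sum using (_⊎_; inj₁; inj₂)
open import Relation.Nullary using (¬_; yes; no; contradiction)
open import Relation.Nullary.Decidable using (from-yes)
open import Relation.Binary.PropositionalEquality
  using (_≡_; refl; sym; trans; cong; cong₂; subst; subst₂; module ≡-Reasoning)

toℚᵘ-ℕ→ℚ : ∀ n → toℚᵘ (ℕ→ℚ n) ≃ mkℚᵘ (+ n) 0
toℚᵘ-ℕ→ℚ n = toℚᵘ-fromℚᵘ (mkℚᵘ (+ n) 0)

ℕ→ℚ-* : ∀ m n → ℕ→ℚ (m ℕ.* n) ≡ ℕ→ℚ m * ℕ→ℚ n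
ℕ→ℚ-* m n = toℚᵘ-injective (begin
  toℚᵘ (ℕ→ℚ (m ℕ.* n))              ≈⟨ toℚᵘ-ℕ→ℚ (m ℕ.* n) ⟩
  mkℚᵘ (+ (m ℕ.* n)) 0              ≡⟨ cong (λ i → mkℚᵘ i 0) (ℤ.pos-* m n) ⟩
  mkℚᵘ (+ m) 0 ℚᵘ.* mkℚᵘ (+ n) 0    ≈⟨ ℚᵘ.*-cong (toℚᵘ-ℕ→ℚ m) (toℚᵘ-ℕ→ℚ n) ⟨
  toℚᵘ (ℕ→ℚ m) ℚᵘ.* toℚᵘ (ℕ→ℚ n)    ≈⟨ toℚᵘ-homo-* (ℕ→ℚ m) (ℕ→ℚ n) ⟨
  toℚᵘ (ℕ→ℚ m * ℕ→ℚ n)              ∎)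
  where open ℚᵘ.≃-Reasoning

ℕ→ℚ-mono-≤ : ∀ {m n} → m ℕ.≤ n → ℕ→ℚ m ≤ ℕ→ℚ n
ℕ→ℚ-mono-≤ {m} {n} m≤n = toℚᵘ-cancel-≤
  (ℚᵘ.≤-respˡ-≃ (ℚᵘ.≃-sym (toℚᵘ-ℕ→ℚ m)) (ℚᵘ.≤-respʳ-≃ (ℚᵘ.≃-sym (toℚᵘ-ℕ→ℚ n))
    (ℚᵘ.*≤* (ℤ.*-monoʳ-≤-nonNeg (+ 1) (ℤ.+≤+ m≤n)))))

ℕ→ℚ-*-mono-≤ : ∀ {m n y} → 0ℚ ≤ y → m ℕ.≤ n → ℕ→ℚ m * y ≤ ℕ→ℚ n * y
ℕ→ℚ-*-mono-≤ {y = y} 0≤y m≤n = *-monoʳ-≤-nonNeg y {{nonNegative 0≤y}} (ℕ→ℚ-mono-≤ m≤n)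

n≤m⇒m≤2*[m/n*n] : ∀ m n .{{_ : ℕ.NonZero n}} → n ℕ.≤ m → m ℕ.≤ 2 ℕ.* (m / n ℕ.* n)
n≤m⇒m≤2*[m/n*n] m n n≤m = begin
  m             ≡⟨ m≡m%n+[m/n]*n m n ⟩
  m % n ℕ.+ q   ≤⟨ ℕ.+-monoˡ-≤ q (ℕ.≤-trans (ℕ.<⇒≤ (m%n<n m n)) n≤q) ⟩
  q ℕ.+ q       ≡⟨ cong (q ℕ.+_) (ℕ.+-identityʳ q) ⟨
  2 ℕ.* q       ∎
  where
  open ℕ.≤-Reasoning
  q = m / n ℕ.* n
  n≤q : n ℕ.≤ q
  n≤q = subst (ℕ._≤ q) (ℕ.*-identityˡ n) (ℕ.*-monoˡ-≤ n (m≥n⇒m/n>0 n≤m))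

mkℚ+-*-denominator : ∀ n d-1 .(c : Coprime n (suc d-1)) →
  mkℚ (+ n) d-1 c * ℕ→ℚ (suc d-1) ≡ ℕ→ℚ n
mkℚ+-*-denominator n d-1 c = toℚᵘ-injective (begin
  toℚᵘ (mkℚ (+ n) d-1 c * D)              ≈⟨ toℚᵘ-homo-* (mkℚ (+ n) d-1 c) D ⟩
  mkℚᵘ (+ n) d-1 ℚᵘ.* toℚᵘ D              ≈⟨ ℚᵘ.*-congˡ {mkℚᵘ (+ n) d-1} (toℚᵘ-ℕ→ℚ (suc d-1)) ⟩
  mkℚᵘ (+ n) d-1 ℚᵘ.* mkℚᵘ (+ suc d-1) 0  ≈⟨ ℚᵘ.*≡* cross ⟩
  mkℚᵘ (+ n) 0                            ≈⟨ toℚᵘ-ℕ→ℚ n ⟨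
  toℚᵘ (ℕ→ℚ n)                            ∎)
  where
  open ℚᵘ.≃-Reasoning
  D = ℕ→ℚ (suc d-1)
  cross : (+ n ℤ.* + suc d-1) ℤ.* + 1 ≡ + n ℤ.* + suc (d-1 ℕ.* 1)
  cross = trans (ℤ.*-identityʳ _) (cong (λ k → + n ℤ.* + suc k) (sym (ℕ.*-identityʳ d-1)))

0≤1 : 0ℚ ≤ 1ℚ
0≤1 = from-yes (0ℚ ≤? 1ℚ)

copies : ℚ → ℕ
copies (mkℚ (+ suc m) d-1 _) = suc d-1 / suc m
copies _ = 0

copies-*-denominator : ∀ m d-1 .(c : Coprime (suc m) (suc d-1)) →
  ℕ→ℚ (copies (mkℚ (+ suc m) d-1 c)) * mkℚ (+ suc m) d-1 c * ℕ→ℚ (suc d-1)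
    ≡ ℕ→ℚ (suc d-1 / suc m ℕ.* suc m)
copies-*-denominator m d-1 c = begin
  K * p * D          ≡⟨ *-assoc K p D ⟩
  K * (p * D)        ≡⟨ cong (K *_) (mkℚ+-*-denominator (suc m) d-1 c) ⟩
  K * ℕ→ℚ (suc m)    ≡⟨ ℕ→ℚ-* (suc d-1 / suc m) (suc m) ⟨
  ℕ→ℚ (suc d-1 / suc m ℕ.* suc m) ∎
  where
  open ≡-Reasoning
  p = mkℚ (+ suc m) d-1 c
  K = ℕ→ℚ (suc d-1 / suc m)
  D = ℕ→ℚ (suc d-1)

copies-fit : ∀ p → ℕ→ℚ (copies p) * p ≤ 1ℚ
copies-fit (mkℚ (+ suc m) d-1 c) = *-cancelʳ-≤-pos D {{normalize-pos (suc d-1) 1}} (begin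
  ℕ→ℚ (copies p) * p * D            ≡⟨ copies-*-denominator m d-1 c ⟩
  ℕ→ℚ (suc d-1 / suc m ℕ.* suc m)   ≤⟨ ℕ→ℚ-mono-≤ (m/n*n≤m (suc d-1) (suc m)) ⟩
  D                                 ≡⟨ *-identityˡ D ⟨
  1ℚ * D                            ∎)
  where
  open ≤-Reasoning
  p = mkℚ (+ suc m) d-1 c
  D = ℕ→ℚ (suc d-1)
copies-fit p@(mkℚ (+ zero) _ _) = ≤-trans (≤-reflexive (*-zeroˡ p)) 0≤1
copies-fit p@(mkℚ -[1+ _ ] _ _) = ≤-trans (≤-reflexive (*-zeroˡ p)) 0≤1

copies-fill-half : ∀ {p} → 0ℚ < p → p ≤ 1ℚ → 1ℚ ≤ ℕ→ℚ 2 * (ℕ→ℚ (copies p) * p)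
copies-fill-half {mkℚ (+ suc m) d-1 c} _ p≤1 = *-cancelʳ-≤-pos D {{normalize-pos (suc d-1) 1}} (begin
  1ℚ * D                                    ≡⟨ *-identityˡ D ⟩
  D                                         ≤⟨ ℕ→ℚ-mono-≤ (n≤m⇒m≤2*[m/n*n] (suc d-1) (suc m) n≤d) ⟩
  ℕ→ℚ (2 ℕ.* (suc d-1 / suc m ℕ.* suc m))   ≡⟨ ℕ→ℚ-* 2 (suc d-1 / suc m ℕ.* suc m) ⟩
  ℕ→ℚ 2 * ℕ→ℚ (suc d-1 / suc m ℕ.* suc m)   ≡⟨ cong (ℕ→ℚ 2 *_) (copies-*-denominator m d-1 c) ⟨
  ℕ→ℚ 2 * (ℕ→ℚ (copies p) * p * D)          ≡⟨ *-assoc (ℕ→ℚ 2) (ℕ→ℚ (copies p) * p) D ⟨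
  ℕ→ℚ 2 * (ℕ→ℚ (copies p) * p) * D          ∎)
  where
  open ≤-Reasoning
  p = mkℚ (+ suc m) d-1 c
  D = ℕ→ℚ (suc d-1)
  n≤d : suc m ℕ.≤ suc d-1
  n≤d = ℤ.drop‿+≤+ (subst₂ ℤ._≤_ (ℤ.*-identityʳ _) (ℤ.*-identityˡ _) (drop-*≤* p≤1))
copies-fill-half {mkℚ (+ zero) _ _} (*<* (ℤ.+<+ ()))
copies-fill-half {mkℚ -[1+ _ ] _ _} (*<* ())

Zeros : List ℚ → Set
Zeros = All (_≡ 0ℚ)

zeros-or-first-positive : ∀ {I} → ValidInstance I → Zeros I ⊎ FirstView (_≡ 0ℚ) (0ℚ <_) I
zeros-or-first-positive [] = inj₁ []
zeros-or-first-positive {x ∷ xs} ((0≤x , _) ∷ valid) with 0ℚ <? x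
... | yes 0<x = inj₂ (First._++_∷_ [] 0<x xs)
... | no 0≮x with ≤-antisym (≮⇒≥ 0≮x) 0≤x | zeros-or-first-positive valid
...   | x≡0 | inj₁ zeros = inj₁ (x≡0 ∷ zeros)
...   | x≡0 | inj₂ (First._++_∷_ zs 0<y ys) = inj₂ (First._++_∷_ (x≡0 ∷ zs) 0<y ys)

gainFrom-zeros-++ : ∀ A hist {zs} ys → Zeros zs →
  gainFrom A hist (zs ++ ys) ≡ gainFrom A (hist ++ zs) ys
gainFrom-zeros-++ A hist ys [] = cong (λ h → gainFrom A h ys) (sym (List.++-identityʳ hist))
gainFrom-zeros-++ A hist {_ ∷ zs} ys (refl ∷ zeros) = begin
  ℕ→ℚ (A hist 0ℚ) * 0ℚ + gainFrom A (hist ++ [ 0ℚ ]) (zs ++ ys)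
    ≡⟨ cong₂ _+_ (*-zeroʳ (ℕ→ℚ (A hist 0ℚ))) (gainFrom-zeros-++ A (hist ++ [ 0ℚ ]) ys zeros) ⟩
  0ℚ + gainFrom A ((hist ++ [ 0ℚ ]) ++ zs) ys
    ≡⟨ +-identityˡ _ ⟩
  gainFrom A ((hist ++ [ 0ℚ ]) ++ zs) ys
    ≡⟨ cong (λ h → gainFrom A h ys) (List.++-assoc hist [ 0ℚ ] zs) ⟩
  gainFrom A (hist ++ 0ℚ ∷ zs) ys ∎
  where open ≡-Reasoning

gain-zeros : ∀ A {I} → Zeros I → gain A I ≡ 0ℚ
gain-zeros A {I} zeros = trans (cong (gain A) (sym (List.++-identityʳ I))) (gainFrom-zeros-++ A [] [] zeros)

packValue-zeros : ∀ {I} ks → Zeros I → packValue I ks ≡ 0ℚ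
packValue-zeros ks [] = refl
packValue-zeros [] (_ ∷ _) = refl
packValue-zeros (k ∷ ks) (refl ∷ zeros) =
  cong₂ _+_ (*-zeroʳ (ℕ→ℚ k)) (packValue-zeros ks zeros)

greedy : OnlineAlg
greedy hist x with all? (_≟ 0ℚ) hist
... | yes _ = copies x
... | no _ = 0

greedy-fresh : ∀ {hist} x → Zeros hist → greedy hist x ≡ copies x
greedy-fresh {hist} x zeros with all? (_≟ 0ℚ) hist
... | yes _ = refl
... | no nonzero = contradiction zeros nonzero

greedy-started : ∀ {hist} x → ¬ Zeros hist → greedy hist x ≡ 0
greedy-started {hist} x nonzero with all? (_≟ 0ℚ) hist
... | yes zeros = contradiction zeros nonzero
... | no _ = refl

gainFrom-greedy-started : ∀ {hist} I → ¬ Zeros hist → gainFrom greedy hist I ≡ 0ℚ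
gainFrom-greedy-started [] _ = refl
gainFrom-greedy-started {hist} (x ∷ xs) nonzero = begin
  ℕ→ℚ (greedy hist x) * x + gainFrom greedy (hist ++ [ x ]) xs
    ≡⟨ cong₂ (λ k g → ℕ→ℚ k * x + g) (greedy-started x nonzero)
             (gainFrom-greedy-started xs (nonzero ∘ ++⁻ˡ hist)) ⟩
  0ℚ * x + 0ℚ
    ≡⟨ cong (_+ 0ℚ) (*-zeroˡ x) ⟩
  0ℚ ∎
  where open ≡-Reasoning

gain-greedy-first-positive : ∀ {zs x} ys → Zeros zs → 0ℚ < x →
  gain greedy (zs ++ x ∷ ys) ≡ ℕ→ℚ (copies x) * x
gain-greedy-first-positive {zs} {x} ys zeros 0<x = begin
  gain greedy (zs ++ x ∷ ys)
    ≡⟨ gainFrom-zeros-++ greedy [] (x ∷ ys) zeros ⟩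
  ℕ→ℚ (greedy zs x) * x + gainFrom greedy (zs ++ [ x ]) ys
    ≡⟨ cong₂ (λ k g → ℕ→ℚ k * x + g) (greedy-fresh x zeros) (gainFrom-greedy-started ys started) ⟩
  ℕ→ℚ (copies x) * x + 0ℚ
    ≡⟨ +-identityʳ _ ⟩
  ℕ→ℚ (copies x) * x ∎
  where
  open ≡-Reasoning
  started : ¬ Zeros (zs ++ [ x ])
  started zeros′ with ++⁻ʳ zs zeros′
  ... | x≡0 ∷ [] = <⇒≢ 0<x (sym x≡0)

greedy-admissible : Admissible greedy
greedy-admissible I valid with zeros-or-first-positive valid
... | inj₁ zeros = ≤-trans (≤-reflexive (gain-zeros greedy zeros)) 0≤1
... | inj₂ (First._++_∷_ {y = x} zeros 0<x ys) =
  ≤-trans (≤-reflexive (gain-greedy-first-positive ys zeros 0<x)) (copies-fit x)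

greedy-2-competitive : ∀ I → ValidInstance I → ∀ ks → FeasiblePacking I ks →
  packValue I ks ≤ ℕ→ℚ 2 * gain greedy I
greedy-2-competitive I valid ks (_ , opt≤1) with zeros-or-first-positive valid
... | inj₁ zeros = ≤-reflexive (begin
  packValue I ks        ≡⟨ packValue-zeros ks zeros ⟩
  0ℚ                    ≡⟨ *-zeroʳ (ℕ→ℚ 2) ⟨
  ℕ→ℚ 2 * 0ℚ            ≡⟨ cong (ℕ→ℚ 2 *_) (gain-zeros greedy zeros) ⟨
  ℕ→ℚ 2 * gain greedy I ∎)
  where open ≡-Reasoning
... | inj₂ (First._++_∷_ {zs} zeros 0<x ys) with ++⁻ʳ zs valid
...   | (_ , x≤1) ∷ _ = ≤-trans opt≤1 (subst (λ g → 1ℚ ≤ ℕ→ℚ 2 * g)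
          (sym (gain-greedy-first-positive ys zeros 0<x)) (copies-fill-half 0<x x≤1))

RatioExceeds : OnlineAlg → ℚ → Set
RatioExceeds A c = Σ Instance λ I → ValidInstance I × Σ (List ℕ) λ ks → FeasiblePacking I ks ×
  (c * gain A I < packValue I ks)

0≤½ : 0ℚ ≤ ½
0≤½ = from-yes (0ℚ ≤? ½)

½<a⇒0≤a : ∀ {a} → ½ < a → 0ℚ ≤ a
½<a⇒0≤a ½<a = <⇒≤ (≤-<-trans 0≤½ ½<a)

single-copy-forced : ∀ {a} → ½ < a → ∀ j k →
  ℕ→ℚ (suc j) * a + (ℕ→ℚ k * ½ + 0ℚ) ≤ 1ℚ → ℕ→ℚ (suc j) * a + (ℕ→ℚ k * ½ + 0ℚ) ≡ a
single-copy-forced {a} _ zero zero _ = trans (+-identityʳ (ℕ→ℚ 1 * a)) (*-identityˡ a)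
single-copy-forced {a} ½<a (suc j) k fits = contradiction (<-≤-trans overfull fits) (<-irrefl refl)
  where
  open ≤-Reasoning
  0≤rest : 0ℚ ≤ ℕ→ℚ k * ½ + 0ℚ
  0≤rest = +-monoˡ-≤ 0ℚ (ℕ→ℚ-*-mono-≤ 0≤½ (ℕ.z≤n {k}))
  overfull : 1ℚ < ℕ→ℚ (2 ℕ.+ j) * a + (ℕ→ℚ k * ½ + 0ℚ)
  overfull = begin-strict
    ℕ→ℚ 2 * ½                 <⟨ *-monoʳ-<-pos (ℕ→ℚ 2) ½<a ⟩
    ℕ→ℚ 2 * a                 ≤⟨ ℕ→ℚ-*-mono-≤ (½<a⇒0≤a ½<a) (ℕ.m≤m+n 2 j) ⟩
    ℕ→ℚ (2 ℕ.+ j) * a         ≡⟨ +-identityʳ (ℕ→ℚ (2 ℕ.+ j) * a) ⟨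
    ℕ→ℚ (2 ℕ.+ j) * a + 0ℚ    ≤⟨ +-monoʳ-≤ (ℕ→ℚ (2 ℕ.+ j) * a) 0≤rest ⟩
    ℕ→ℚ (2 ℕ.+ j) * a + (ℕ→ℚ k * ½ + 0ℚ) ∎
single-copy-forced {a} ½<a zero (suc k) fits = contradiction (<-≤-trans overfull fits) (<-irrefl refl)
  where
  open ≤-Reasoning
  overfull : 1ℚ < ℕ→ℚ 1 * a + (ℕ→ℚ (suc k) * ½ + 0ℚ)
  overfull = begin-strict
    ½ + ½    <⟨ +-monoˡ-< ½ ½<a ⟩
    a + ½    ≤⟨ +-mono-≤ (≤-reflexive (sym (*-identityˡ a)))
                         (+-monoˡ-≤ 0ℚ (ℕ→ℚ-*-mono-≤ 0≤½ (ℕ.s≤s (ℕ.z≤n {k})))) ⟩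
    ℕ→ℚ 1 * a + (ℕ→ℚ (suc k) * ½ + 0ℚ) ∎

adversary : ∀ {A a c} → Admissible A → ½ < a → a ≤ 1ℚ → c * a < 1ℚ → RatioExceeds A c
adversary {A} {a} {c} admissible ½<a a≤1 ca<1 with A [] a in taken
... | zero = a ∷ [] , (½<a⇒0≤a ½<a , a≤1) ∷ [] , 1 ∷ [] , (refl , opt≤1) , c*gain<opt
  where
  opt≡a : packValue (a ∷ []) (1 ∷ []) ≡ a
  opt≡a = trans (+-identityʳ (ℕ→ℚ 1 * a)) (*-identityˡ a)
  opt≤1 : packValue (a ∷ []) (1 ∷ []) ≤ 1ℚ
  opt≤1 = subst (_≤ 1ℚ) (sym opt≡a) a≤1
  c*gain≡0 : c * gain A (a ∷ []) ≡ 0ℚ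
  c*gain≡0 = begin
    c * (ℕ→ℚ (A [] a) * a + 0ℚ) ≡⟨ cong (λ k → c * (ℕ→ℚ k * a + 0ℚ)) taken ⟩
    c * (0ℚ * a + 0ℚ)           ≡⟨ cong (λ g → c * (g + 0ℚ)) (*-zeroˡ a) ⟩
    c * 0ℚ                      ≡⟨ *-zeroʳ c ⟩
    0ℚ                          ∎
    where open ≡-Reasoning
  c*gain<opt : c * gain A (a ∷ []) < packValue (a ∷ []) (1 ∷ [])
  c*gain<opt = subst₂ _<_ (sym c*gain≡0) (sym opt≡a) (≤-<-trans 0≤½ ½<a)
... | suc j = I , valid , 0 ∷ 2 ∷ [] , (refl , ≤-reflexive opt≡1) , c*gain<opt
  where
  I = a ∷ ½ ∷ []
  valid : ValidInstance I
  valid = (½<a⇒0≤a ½<a , a≤1) ∷ (0≤½ , from-yes (½ ≤? 1ℚ)) ∷ []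
  opt≡1 : packValue I (0 ∷ 2 ∷ []) ≡ 1ℚ
  opt≡1 = trans (cong (_+ 1ℚ) (*-zeroˡ a)) (+-identityˡ 1ℚ)
  k = A (a ∷ []) ½
  gain≡ : gain A I ≡ ℕ→ℚ (suc j) * a + (ℕ→ℚ k * ½ + 0ℚ)
  gain≡ = cong (λ i → ℕ→ℚ i * a + (ℕ→ℚ k * ½ + 0ℚ)) taken
  gain≡a : gain A I ≡ a
  gain≡a = trans gain≡ (single-copy-forced ½<a j k (subst (_≤ 1ℚ) gain≡ (admissible I valid)))
  c*gain<opt : c * gain A I < packValue I (0 ∷ 2 ∷ [])
  c*gain<opt = subst₂ _<_ (cong (c *_) (sym gain≡a)) (sym opt≡1) ca<1

size-against : ∀ {c} → c < ℕ→ℚ 2 → Σ ℚ λ a → ½ < a × a ≤ 1ℚ × c * a < 1ℚ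
size-against {c} c<2 with c ≤? 1ℚ
... | yes c≤1 = ¾ , from-yes (½ <? ¾) , from-yes (¾ ≤? 1ℚ) ,
                ≤-<-trans (*-monoʳ-≤-nonNeg ¾ c≤1) (from-yes (1ℚ * ¾ <? 1ℚ))
  where ¾ = + 3 /ℚ 4
... | no c≰1 = a , ½<a , a≤1 , ca<1
  where
  ¼ = + 1 /ℚ 4
  a = 1ℚ - c * ¼
  e = 1ℚ - c * ½
  ½<a : ½ < a
  ½<a = +-monoʳ-< 1ℚ (neg-antimono-< (*-monoˡ-<-pos ¼ c<2))
  0≤c : 0ℚ ≤ c
  0≤c = ≤-trans 0≤1 (<⇒≤ (≰⇒> c≰1))
  a≤1 : a ≤ 1ℚ
  a≤1 = +-monoʳ-≤ 1ℚ (neg-antimono-≤ (*-monoʳ-≤-nonNeg ¼ 0≤c))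
  0<e : 0ℚ < e
  0<e = +-monoʳ-< 1ℚ (neg-antimono-< (*-monoˡ-<-pos ½ c<2))
  -- c (1 − c/4) = 1 − (1 − c/2)², which stays below 1 because c ≠ 2.
  c*a+e²≡1 : c * a + e * e ≡ 1ℚ
  c*a+e²≡1 = solve 1 (λ c → c :* (con 1ℚ :- c :* con ¼) :+ (con 1ℚ :- c :* con ½) :* (con 1ℚ :- c :* con ½)
                            := con 1ℚ) refl c
    where open +-*-Solver
  0<e*e : 0ℚ < e * e
  0<e*e = positive⁻¹ (e * e) {{pos*pos⇒pos e {{positive 0<e}} e {{positive 0<e}}}}
  ca<1 : c * a < 1ℚ
  ca<1 = begin-strict
    c * a         ≡⟨ +-identityʳ (c * a) ⟨
    c * a + 0ℚ    <⟨ +-monoʳ-< (c * a) 0<e*e ⟩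
    c * a + e * e ≡⟨ c*a+e²≡1 ⟩
    1ℚ            ∎
    where open ≤-Reasoning

below-2-exceeded : ∀ {A c} → Admissible A → c < ℕ→ℚ 2 → RatioExceeds A c
below-2-exceeded {c = c} admissible c<2 with size-against c<2
... | a , ½<a , a≤1 , ca<1 = adversary {c = c} admissible ½<a a≤1 ca<1

theorem1 :
    (Σ OnlineAlg λ A → Admissible A ×
        ((I : Instance) → ValidInstance I → (ks : List ℕ) → FeasiblePacking I ks →
          packValue I ks ≤ ℕ→ℚ 2 * gain A I))
    ×
    ((A : OnlineAlg) → Admissible A → (c : ℚ) → c < ℕ→ℚ 2 →
      Σ Instance λ I → ValidInstance I × Σ (List ℕ) λ ks → FeasiblePacking I ks ×
        (c * gain A I < packValue I ks))
theorem1 =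
  (greedy , greedy-admissible , greedy-2-competitive) ,
  λ A admissible c → below-2-exceeded {A} {c} admissible
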